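{- For all integers $k,l\ge1$, the spaces $\mathrm{gr}^{W,L}_{k,l}(\mathcal{MD})$ and $\mathrm{gr}^{W,L}_{k,l}(\mathcal{MD}^{adm})$ are finite dimensional, with \[ \dim_{\mathbb{Q}}\mathrm{gr}^{W,L}_{k,l}(\mathcal{MD})\le\binom{k-1}{l-1},\qquad \dim_{\mathbb{Q}}\mathrm{gr}^{W,L}_{k,l}(\mathcal{MD}^{adm})\le\binom{k-2}{l-1}. \]
   Context: For integers $r_1,\dots,r_l\ge 0$ and $n\ge 1$ let $\sigma_{r_1,\dots,r_l}(n)=\sum v_1^{r_1}\cdots v_l^{r_l}$, summed over positive integers $u_1>\dots>u_l>0$, $v_1,\dots,v_l>0$ with $u_1v_1+\dots+u_lv_l=n$. For integers $s_1,\dots,s_l\ge1$ the bracket is $[s_1,\dots,s_l]=\frac{1}{(s_1-1)!\cdots(s_l-1)!}\sum_{n>0}\sigma_{s_1-1,\dots,s_l-1}(n)q^n\in\mathbb{Q}[[q]]$, of weight $s_1+\dots+s_l$ and length $l$ ($1$ has weight and length $0$). $\mathcal{MD}$ is the $\mathbb{Q}$-span of $1$ and all brackets; $\mathcal{MD}^{adm}$ the span of $1$ and brackets with $s_1>1$. For $V\in\{\mathcal{MD},\mathcal{MD}^{adm}\}$, $\mathrm{Fil}^{W,L}_{k,l}(V)$ is the span of those generators of $V$ (including $1$) of weight $\le k$ and length $\le l$, and $\mathrm{gr}^{W,L}_{k,l}(V)=\mathrm{Fil}^{W,L}_{k,l}(V)/(\mathrm{Fil}^{W,L}_{k-1,l}(V)+\mathrm{Fil}^{W,L}_{k,l-1}(V))$.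 Here $\binom{n}{m}$ denotes the number of $m$-element subsets of an $n$-element set, taken to be $0$ if $n<m$ or $n<0$. -}

module Defs where

open import Data.Nat as ℕ using (ℕ; zero; suc; _+_; _*_; _∸_; _^_; _≤_; _<_; _!; NonZero)
open import Data.Nat.Properties using (_!≢0; m*n≢0)
open import Data.Nat.Combinatorics using (_C_)
open import Data.Integer as ℤ using (ℤ; +_; -[1+_])
open import Data.Rational as ℚ using (ℚ; _/_)
open import Data.List using (List; []; _∷_; length; map)
open import Data.Nat.ListAction using (sum)
open import Data.Bool using (if_then_else_)
open import Data.List.Relation.Unary.All using (All)
open import Data.List.Membership.Propositional using (_∈_)
open import Data.Product using (_×_; Σ; ∃; _,_; proj₁; proj₂)
open import Data.Sum using (_⊎_)
open import Data.Unit using (⊤)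
open import Data.Empty using (⊥)
open import Relation.Binary.PropositionalEquality using (_≡_)

-- A composition (s₁,…,s_l) is a list of naturals; it indexes a bracket
-- when every entry is ≥ 1.  The empty list indexes the generator 1.
Composition : Set
Composition = List ℕ

weight : Composition → ℕ
weight = sum

sumFrom1 : ℕ → (ℕ → ℕ) → ℕ
sumFrom1 zero    f = 0
sumFrom1 (suc m) f = sumFrom1 m f + f (suc m)

-- T rs b n = Σ v₁^{r₁}⋯v_l^{r_l} over b > u₁ > ⋯ > u_l > 0, v_i > 0,
--            u₁v₁ + ⋯ + u_lv_l = n.
T : List ℕ → ℕ → ℕ → ℕ
T []       b n = if0 n
  where
  if0 : ℕ → ℕ
  if0 zero    = 1
  if0 (suc _) = 0
T (r ∷ rs) b n =
  sumFrom1 (b ∸ 1) λ u → sumFrom1 n λ v →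
    (if (u * v) ℕ.≤ᵇ n then v ^ r * T rs u (n ∸ u * v) else 0)

-- σ_{r₁,…,r_l}(n)  (any u₁ occurring is ≤ n, so the bound n+1 is harmless)
σ : List ℕ → ℕ → ℕ
σ rs n = T rs (suc n) n

factProd : Composition → ℕ
factProd []       = 1
factProd (s ∷ ss) = (s ∸ 1) ! * factProd ss

factProd≢0 : ∀ ss → NonZero (factProd ss)
factProd≢0 []       = _
factProd≢0 (s ∷ ss) = m*n≢0 _ _ {{(s ∸ 1) !≢0}} {{factProd≢0 ss}}

PowerSeries : Set
PowerSeries = ℕ → ℚ

bracket : Composition → PowerSeries
bracket [] zero    = ℚ.1ℚ
bracket [] (suc n) = ℚ.0ℚ
bracket (s ∷ ss) zero    = ℚ.0ℚ
bracket (s ∷ ss) (suc n) =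
  (+ σ (map (_∸ 1) (s ∷ ss)) (suc n) / factProd (s ∷ ss)) {{factProd≢0 (s ∷ ss)}}

GenMD : Composition → Set
GenMD ss = All (1 ≤_) ss

GenAdm : Composition → Set
GenAdm []       = ⊤
GenAdm (s ∷ ss) = (1 < s) × All (1 ≤_) ss

Fil : (Composition → Set) → ℕ → ℕ → Composition → Set
Fil Gen k l ss = Gen ss × weight ss ≤ k × length ss ≤ l

linComb : List (ℚ × Composition) → PowerSeries
linComb []             n = ℚ.0ℚ
linComb ((c , t) ∷ cs) n = c ℚ.* bracket t n ℚ.+ linComb cs n

InSpan : (Composition → Set) → PowerSeries → Set
InSpan P f = Σ (List (ℚ × Composition)) λ cs →
  All (λ c → P (proj₂ c)) cs × (∀ n → f n ≡ linComb cs n)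

-- dim_ℚ gr^{W,L}_{k,l}(V) ≤ N (and finite): the quotient
-- Fil_{k,l} / (Fil_{k-1,l} + Fil_{k,l-1}) is spanned by the images of
-- at most N elements of Fil_{k,l}, which are taken among its generators.
GrDimLe : (Composition → Set) → ℕ → ℕ → ℕ → Set
GrDimLe Gen k l N = Σ (List Composition) λ gs →
  length gs ≤ N × All (Fil Gen k l) gs ×
  (∀ ss → Fil Gen k l ss →
     InSpan (λ t → t ∈ gs ⊎ Fil Gen (k ∸ 1) l t ⊎ Fil Gen k (l ∸ 1) t)
            (bracket ss))

binomℤ : ℤ → ℕ → ℕ
binomℤ (+ n)    m = n C m
binomℤ -[1+ n ] m = 0

{-# OPTIONS --safe #-}
module Submission where

-- Modulo the lower filtration pieces, every bracket of weight < k or length < l vanishes, so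
-- gr_{k,l} is spanned by the brackets of weight exactly k and length exactly l.  These are
-- indexed by the compositions of k into l positive parts, of which there are C(k-1, l-1)
-- (Pascal's rule, splitting on whether the first part is 1).  The admissible ones, with first
-- part ≥ 2, are obtained from the compositions of k-1 into l parts by increasing the first
-- part, so there are C(k-2, l-1) of them.

open import Defs
open import Data.Nat using (ℕ; zero; suc; _+_; _≤_; _∸_; _≟_; s≤s; z≤n)
open import Data.Nat.Properties using (≤-reflexive; ≤∧≢⇒<; <⇒≤pred)
open import Data.Nat.Combinatorics using (_C_; nCk+nC[k+1]≡[n+1]C[k+1])
open import Data.Integer using (+_; _-_)
open import Data.Product using (_×_; _,_)
open import Data.Sum using (_⊎_; inj₁; inj₂)
open import Data.List using (List; []; _∷_; _++_; map; length; [_])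
open import Data.List.Properties using (length-++; length-map)
open import Data.List.Relation.Unary.All as All using (All; []; _∷_)
import Data.List.Relation.Unary.All.Properties as All
open import Data.List.Membership.Propositional using (_∈_)
open import Data.List.Membership.Propositional.Properties using (∈-map⁺; ∈-++⁺ˡ; ∈-++⁺ʳ)
open import Data.List.Relation.Unary.Any using (here)
open import Relation.Nullary using (yes; no)
open import Relation.Binary.PropositionalEquality using (_≡_; refl; sym; trans; cong; cong₂; subst₂; module ≡-Reasoning)
import Data.Rational as ℚ
import Data.Rational.Properties as ℚₚ

sucHead : Composition → Composition
sucHead []       = []
sucHead (s ∷ ss) = suc s ∷ ss

compositions : ℕ → ℕ → List Composition
compositions zero    zero    = [ [] ]
compositions zero    (suc l) = []
compositions (suc k) zero    = []
compositions (suc k) (suc l) =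
  map (1 ∷_) (compositions k l) ++ map sucHead (compositions k (suc l))

Exact : (Composition → Set) → ℕ → ℕ → Composition → Set
Exact Gen k l ss = Gen ss × weight ss ≡ k × length ss ≡ l

length-compositions-suc : ∀ k l →
  length (compositions (suc k) (suc l)) ≡ length (compositions k l) + length (compositions k (suc l))
length-compositions-suc k l = begin
  length (map (1 ∷_) (compositions k l) ++ map sucHead (compositions k (suc l)))
    ≡⟨ length-++ (map (1 ∷_) (compositions k l)) ⟩
  length (map (1 ∷_) (compositions k l)) + length (map sucHead (compositions k (suc l)))
    ≡⟨ cong₂ _+_ (length-map (1 ∷_) (compositions k l)) (length-map sucHead (compositions k (suc l))) ⟩
  length (compositions k l) + length (compositions k (suc l)) ∎
  where open ≡-Reasoning

length-compositions : ∀ k l → length (compositions (suc k) (suc l)) ≡ k C l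
length-compositions zero    zero    = refl
length-compositions zero    (suc l) = refl
length-compositions (suc k) zero    = trans (length-compositions-suc (suc k) zero) (length-compositions k zero)
length-compositions (suc k) (suc l) = begin
  length (compositions (suc (suc k)) (suc (suc l)))
    ≡⟨ length-compositions-suc (suc k) (suc l) ⟩
  length (compositions (suc k) (suc l)) + length (compositions (suc k) (suc (suc l)))
    ≡⟨ cong₂ _+_ (length-compositions k l) (length-compositions k (suc l)) ⟩
  k C l + k C suc l
    ≡⟨ nCk+nC[k+1]≡[n+1]C[k+1] k l ⟩
  suc k C suc l ∎
  where open ≡-Reasoning

compositions-sound : ∀ k l → All (Exact GenMD k l) (compositions k l)
compositions-sound zero    zero    = ([] , refl , refl) ∷ []
compositions-sound zero    (suc l) = []
compositions-sound (suc k) zero    = []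
compositions-sound (suc k) (suc l) =
  All.++⁺ (All.map⁺ (All.map cons-one (compositions-sound k l)))
          (All.map⁺ (All.map sucHead-sound (compositions-sound k (suc l))))
  where
  cons-one : ∀ {ss} → Exact GenMD k l ss → Exact GenMD (suc k) (suc l) (1 ∷ ss)
  cons-one (pos , w , n) = s≤s z≤n ∷ pos , cong suc w , cong suc n

  sucHead-sound : ∀ {ss} → Exact GenMD k (suc l) ss → Exact GenMD (suc k) (suc l) (sucHead ss)
  sucHead-sound {_ ∷ _} (_ ∷ pos , w , n) = s≤s z≤n ∷ pos , cong suc w , n

sucHead-∈-compositions : ∀ s rest → rest ∈ compositions (weight rest) (length rest) →
  (suc s ∷ rest) ∈ compositions (suc s + weight rest) (suc (length rest))
sucHead-∈-compositions zero    rest rest∈ = ∈-++⁺ˡ (∈-map⁺ (1 ∷_) rest∈)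
sucHead-∈-compositions (suc s) rest rest∈ =
  ∈-++⁺ʳ _ (∈-map⁺ sucHead (sucHead-∈-compositions s rest rest∈))

∈-compositions : ∀ ss → GenMD ss → ss ∈ compositions (weight ss) (length ss)
∈-compositions []             []        = here refl
∈-compositions (suc s ∷ rest) (_ ∷ pos) = sucHead-∈-compositions s rest (∈-compositions rest pos)

Exact⇒Fil : ∀ {Gen k l ss} → Exact Gen k l ss → Fil Gen k l ss
Exact⇒Fil (g , w , n) = g , ≤-reflexive w , ≤-reflexive n

Fil-exact-or-lower : ∀ {Gen k l ss} → Fil Gen k l ss →
  Exact Gen k l ss ⊎ Fil Gen (k ∸ 1) l ss ⊎ Fil Gen k (l ∸ 1) ss
Fil-exact-or-lower {k = k} {l} {ss} (g , w≤k , n≤l) with weight ss ≟ k | length ss ≟ l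
... | yes w≡k | yes n≡l = inj₁ (g , w≡k , n≡l)
... | no  w≢k | _       = inj₂ (inj₁ (g , <⇒≤pred (≤∧≢⇒< w≤k w≢k) , n≤l))
... | yes _   | no  n≢l = inj₂ (inj₂ (g , w≤k , <⇒≤pred (≤∧≢⇒< n≤l n≢l)))

bracket-InSpan : ∀ {P ss} → P ss → InSpan P (bracket ss)
bracket-InSpan {ss = ss} p =
  [ (ℚ.1ℚ , ss) ] , p ∷ [] , λ n → sym (trans (ℚₚ.+-identityʳ _) (ℚₚ.*-identityˡ _))

GrDimLe-fromExact : ∀ Gen k l N (gs : List Composition) →
  length gs ≤ N → All (Fil Gen k l) gs → (∀ {ss} → Exact Gen k l ss → ss ∈ gs) →
  GrDimLe Gen k l N
GrDimLe-fromExact Gen k l N gs len≤N gs⊆Fil exact∈gs = gs , len≤N , gs⊆Fil , spans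
  where
  spans : ∀ ss → Fil Gen k l ss →
    InSpan (λ t → t ∈ gs ⊎ Fil Gen (k ∸ 1) l t ⊎ Fil Gen k (l ∸ 1) t) (bracket ss)
  spans ss fil with Fil-exact-or-lower {Gen} {k} {l} {ss} fil
  ... | inj₁ exact = bracket-InSpan {ss = ss} (inj₁ (exact∈gs exact))
  ... | inj₂ lower = bracket-InSpan {ss = ss} (inj₂ lower)

GrDimLe-MD : ∀ k l → GrDimLe GenMD (suc k) (suc l) (k C l)
GrDimLe-MD k l = GrDimLe-fromExact GenMD (suc k) (suc l) (k C l) (compositions (suc k) (suc l))
  (≤-reflexive (length-compositions k l))
  (All.map (Exact⇒Fil {GenMD} {suc k} {suc l}) (compositions-sound (suc k) (suc l)))
  λ { {ss} (g , w , n) → subst₂ (λ a b → ss ∈ compositions a b) w n (∈-compositions ss g) }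

admissibleCompositions : ℕ → ℕ → List Composition
admissibleCompositions k l = map sucHead (compositions k l)

admissibleCompositions-sound : ∀ k l → All (Fil GenAdm (suc k) (suc l)) (admissibleCompositions k (suc l))
admissibleCompositions-sound k l = All.map⁺ (All.map sucHead-Fil (compositions-sound k (suc l)))
  where
  sucHead-Fil : ∀ {ss} → Exact GenMD k (suc l) ss → Fil GenAdm (suc k) (suc l) (sucHead ss)
  sucHead-Fil {_ ∷ _} (s≤s _ ∷ pos , w , n) = (s≤s (s≤s z≤n) , pos) , ≤-reflexive (cong suc w) , ≤-reflexive n

∈-admissibleCompositions : ∀ {k l ss} → Exact GenAdm (suc k) (suc l) ss → ss ∈ admissibleCompositions k (suc l)
∈-admissibleCompositions {ss = suc zero ∷ _} ((s≤s () , _) , _)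
∈-admissibleCompositions {ss = suc (suc s) ∷ rest} ((_ , pos) , refl , refl) =
  ∈-map⁺ sucHead (∈-compositions (suc s ∷ rest) (s≤s z≤n ∷ pos))

length-admissibleCompositions : ∀ k l →
  length (admissibleCompositions k (suc l)) ≤ binomℤ (+ suc k - + 2) l
length-admissibleCompositions zero    l = z≤n
length-admissibleCompositions (suc k) l =
  ≤-reflexive (trans (length-map sucHead (compositions (suc k) (suc l))) (length-compositions k l))

GrDimLe-Adm : ∀ k l → GrDimLe GenAdm (suc k) (suc l) (binomℤ (+ suc k - + 2) l)
GrDimLe-Adm k l = GrDimLe-fromExact GenAdm (suc k) (suc l) _ (admissibleCompositions k (suc l))
  (length-admissibleCompositions k l) (admissibleCompositions-sound k l) ∈-admissibleCompositions

mainTheorem16 : ∀ (k l : ℕ) → 1 ≤ k → 1 ≤ l →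
    GrDimLe GenMD k l (binomℤ ((+ k) - (+ 1)) (l ∸ 1))
      × GrDimLe GenAdm k l (binomℤ ((+ k) - (+ 2)) (l ∸ 1))
mainTheorem16 (suc k) (suc l) _ _ = GrDimLe-MD k l , GrDimLe-Adm k l
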